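{- The class $\overrightarrow{\mathcal T}$ of all finite two-graphs equipped with a linear ordering of their vertices is not Ramsey for colouring pairs of vertices: there exists $\overrightarrow{\mathbf B}\in\overrightarrow{\mathcal T}$ such that no $\overrightarrow{\mathbf C}\in\overrightarrow{\mathcal T}$ satisfies $\overrightarrow{\mathbf C}\longrightarrow(\overrightarrow{\mathbf B})^{\overrightarrow{\mathbf E}}_2$, where $\overrightarrow{\mathbf E}$ is the unique ordered two-graph on two vertices.
   Context: A two-graph is a 3-uniform hypergraph in which every 4-vertex set contains an even number of hyperedges. An ordered two-graph is a two-graph together with a linear order of its vertices; substructures are induced (inheriting hyperedges and order). A copy of $\overrightarrow{\mathbf A}$ in $\overrightarrow{\mathbf C}$ is a substructure of $\overrightarrow{\mathbf C}$ isomorphic to $\overrightarrow{\mathbf A}$. The notation $\overrightarrow{\mathbf C}\longrightarrow(\overrightarrow{\mathbf B})^{\overrightarrow{\mathbf E}}_2$ means that for every colouring of the copies of $\overrightarrow{\mathbf E}$ in $\overrightarrow{\mathbf C}$ with 2 colours there is a copy of $\overrightarrow{\mathbf B}$ in $\overrightarrow{\mathbf C}$ all of whose copies of $\overrightarrow{\mathbf E}$ have the same colour. -}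

module Defs where

open import Data.Nat using (ℕ)
open import Data.Fin using (Fin; _<_)
open import Data.Bool using (Bool; false; _xor_)
open import Data.Product using (Σ; ∃; _×_)
open import Relation.Binary.PropositionalEquality using (_≡_)
open import Relation.Nullary using (¬_)

-- The 3-element set {i,j,k} with i < j < k is a
-- hyperedge iff  edge i j k ≡ true ; values of 'edge' on non-increasing
-- triples are irrelevant (never consulted).
record Ordered3Hypergraph : Set where
  field
    size : ℕ
    edge : Fin size → Fin size → Fin size → Bool
open Ordered3Hypergraph public

IsTwoGraph : Ordered3Hypergraph → Set
IsTwoGraph H = ∀ (a b c d : Fin (size H)) → a < b → b < c → c < d →
  ((edge H a b c xor edge H a b d) xor (edge H a c d xor edge H b c d)) ≡ false

record OrderedTwoGraph : Set where
  field
    graph : Ordered3Hypergraph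
    twoGraph : IsTwoGraph graph
open OrderedTwoGraph public

V : OrderedTwoGraph → Set
V A = Fin (size (graph A))

E : (A : OrderedTwoGraph) → V A → V A → V A → Bool
E A = edge (graph A)

-- Copies of A in C (induced substructures
-- of C isomorphic to A) correspond bijectively to embeddings A → C, since
-- ordered structures are rigid.
record Embedding (A C : OrderedTwoGraph) : Set where
  field
    map : V A → V C
    mono : ∀ {i j : V A} → i < j → map i < map j
    preservesEdges : ∀ (i j k : V A) → i < j → j < k →
      E C (map i) (map j) (map k) ≡ E A i j k
open Embedding public

-- Copies of E (the unique ordered two-graph on two vertices) in C are exactly
-- the pairs i < j of vertices of C.  A 2-colouring of these copies:
PairColouring : OrderedTwoGraph → Set
PairColouring C = (i j : V C) → i < j → Bool

Arrows : OrderedTwoGraph → OrderedTwoGraph → Set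
Arrows C B = ∀ (χ : PairColouring C) → Σ (Embedding B C) λ f → Σ Bool λ col →
  ∀ (i j : V B) (p : i < j) → χ (map f i) (map f j) (mono f p) ≡ col

module Submission where

-- Fix a vertex a of a two-graph C and colour every pair {i, j} of C by
-- whether {a, i, j} is a hyperedge (the "link" of a).  The two-graph
-- parity condition on {a, b, c, d} shows that the link of a determines
-- every triple above a:  E(b,c,d) = E(a,b,c) ⊕ E(a,b,d) ⊕ E(a,c,d).
-- Hence in a copy of B whose pairs are monochromatic of colour col and
-- which lies above a (apart from its least vertex), every triple avoiding
-- the least vertex of B has value col ⊕ col ⊕ col = col.
--
-- Colouring the
-- pairs of any C by the link of its least vertex therefore leaves no
-- monochromatic copy of B.

open import Defs
open import Data.Product using (Σ; _,_; proj₁; proj₂)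
open import Relation.Nullary using (¬_)
open import Data.Empty using (⊥)
open import Data.Nat using (ℕ; suc; z≤n; _≡ᵇ_)
open import Data.Nat.Properties using (n<1+n; ≤-<-trans)
open import Data.Fin using (Fin; _<_; _≤_; zero; toℕ; #_)
open import Data.Fin.Properties using (<-trans)
open import Data.Bool using (Bool; true; false; _xor_; _∧_)
open import Data.Bool.Properties using (xor-assoc; xor-same; xor-∧-commutativeRing)
open import Algebra.Bundles using (CommutativeRing)
open import Relation.Binary.PropositionalEquality
  using (_≡_; refl; sym; trans; cong; cong₂; module ≡-Reasoning)

open import Algebra.Solver.CommutativeMonoid
  (CommutativeRing.+-commutativeMonoid xor-∧-commutativeRing)
  using (solve; _⊜_; _⊕_)

xor-false⇒≡ : ∀ x y → x xor y ≡ false → x ≡ y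
xor-false⇒≡ false false _ = refl
xor-false⇒≡ true  true  _ = refl

xor-thrice : ∀ c → (c xor c) xor c ≡ c
xor-thrice c = cong (_xor c) (xor-same c)

link : ∀ {H} → IsTwoGraph H → ∀ {a b c d : Fin (size H)} →
  a < b → b < c → c < d →
  edge H b c d ≡ (edge H a b c xor edge H a b d) xor edge H a c d
link {H} isTwo {a} {b} {c} {d} a<b b<c c<d =
  sym (xor-false⇒≡ ((abc xor abd) xor acd) bcd
    (trans (xor-assoc (abc xor abd) acd bcd) (isTwo a b c d a<b b<c c<d)))
  where
    abc abd acd bcd : Bool
    abc = edge H a b c
    abd = edge H a b d
    acd = edge H a c d
    bcd = edge H b c d

linkColouring : (C : OrderedTwoGraph) → V C → PairColouring C
linkColouring C a i j _ = E C a i j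

monochromaticLink : ∀ {B C : OrderedTwoGraph} (f : Embedding B C) (a : V C) (col : Bool) →
  (∀ (i j : V B) (p : i < j) → linkColouring C a (map f i) (map f j) (mono f p) ≡ col) →
  ∀ {i j k : V B} → a < map f i → i < j → j < k → E B i j k ≡ col
monochromaticLink {B} {C} f a col mono-col {i} {j} {k} a<fi i<j j<k = begin
  E B i j k
    ≡⟨ sym (preservesEdges f i j k i<j j<k) ⟩
  E C (map f i) (map f j) (map f k)
    ≡⟨ link {graph C} (twoGraph C) a<fi (mono f i<j) (mono f j<k) ⟩
  (E C a (map f i) (map f j) xor E C a (map f i) (map f k)) xor E C a (map f j) (map f k)
    ≡⟨ cong₂ _xor_ (cong₂ _xor_ (mono-col i j i<j) (mono-col i k i<k)) (mono-col j k j<k) ⟩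
  (col xor col) xor col
    ≡⟨ xor-thrice col ⟩
  col ∎
  where
    open ≡-Reasoning
    i<k : i < k
    i<k = <-trans i<j j<k

-- In the sum of the four triangles of a 4-set, every pair occurs twice.
fourTriangles : ∀ ab ac ad bc bd cd →
  ((((ab xor ac) xor bc) xor ((ab xor ad) xor bd)) xor
   (((ac xor ad) xor cd) xor ((bc xor bd) xor cd))) ≡ false
fourTriangles ab ac ad bc bd cd = begin
  (((ab xor ac) xor bc) xor ((ab xor ad) xor bd)) xor
    (((ac xor ad) xor cd) xor ((bc xor bd) xor cd))
    ≡⟨ pairUp ⟩
  (ab xor ab) xor ((ac xor ac) xor ((ad xor ad) xor
    ((bc xor bc) xor ((bd xor bd) xor (cd xor cd)))))
    ≡⟨ cong₂ _xor_ (xor-same ab) (cong₂ _xor_ (xor-same ac) (cong₂ _xor_ (xor-same ad)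
         (cong₂ _xor_ (xor-same bc) (cong₂ _xor_ (xor-same bd) (xor-same cd))))) ⟩
  false ∎
  where
    open ≡-Reasoning
    pairUp : (((ab xor ac) xor bc) xor ((ab xor ad) xor bd)) xor
               (((ac xor ad) xor cd) xor ((bc xor bd) xor cd))
           ≡ (ab xor ab) xor ((ac xor ac) xor ((ad xor ad) xor
               ((bc xor bc) xor ((bd xor bd) xor (cd xor cd)))))
    pairUp = solve 6 (λ ab ac ad bc bd cd →
      (((ab ⊕ ac) ⊕ bc) ⊕ ((ab ⊕ ad) ⊕ bd)) ⊕ (((ac ⊕ ad) ⊕ cd) ⊕ ((bc ⊕ bd) ⊕ cd))
      ⊜ (ab ⊕ ab) ⊕ ((ac ⊕ ac) ⊕ ((ad ⊕ ad) ⊕ ((bc ⊕ bc) ⊕ ((bd ⊕ bd) ⊕ (cd ⊕ cd))))))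
      refl ab ac ad bc bd cd

graphTwoGraph : (n : ℕ) → (Fin n → Fin n → Bool) → OrderedTwoGraph
graphTwoGraph n g = record
  { graph = record { size = n ; edge = λ i j k → (g i j xor g i k) xor g j k }
  ; twoGraph = λ a b c d _ _ _ →
      fourTriangles (g a b) (g a c) (g a d) (g b c) (g b d) (g c d)
  }

singleEdge : Fin 5 → Fin 5 → Bool
singleEdge i j = (toℕ i ≡ᵇ 3) ∧ (toℕ j ≡ᵇ 4)

-- The witness B: its triples {1,2,3} and {2,3,4} differ.
B : OrderedTwoGraph
B = graphTwoGraph 5 singleEdge

least : ∀ {n} → Fin n → Fin n
least {suc n} _ = zero

least-≤ : ∀ {n} (v w : Fin n) → least v ≤ w
least-≤ {suc n} v w = z≤n

-- A copy of B whose pairs are monochromatic for the link of a vertex a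
-- below its vertex 1 is impossible: its triples {1,2,3} (a non-edge) and
-- {2,3,4} (an edge) would both receive the colour of the copy.
noLinkMonochromaticB : ∀ {C} (f : Embedding B C) (a : V C) (col : Bool) →
  (∀ (i j : V B) (p : i < j) → linkColouring C a (map f i) (map f j) (mono f p) ≡ col) →
  a < map f (# 1) → ⊥
noLinkMonochromaticB f a col mono-col a<f1 = false≢true (trans triple₁₂₃ (sym triple₂₃₄))
  where
    triple₁₂₃ : false ≡ col
    triple₁₂₃ = monochromaticLink f a col mono-col a<f1 (n<1+n 1) (n<1+n 2)
    triple₂₃₄ : true ≡ col
    triple₂₃₄ = monochromaticLink f a col mono-col
      (<-trans a<f1 (mono f (n<1+n 1))) (n<1+n 2) (n<1+n 3)
    false≢true : false ≡ true → ⊥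
    false≢true ()

-- A two-graph arrowing B contains a copy of B, so it has a least vertex.
leastVertex : ∀ {C} → Arrows C B → V C
leastVertex arrows = least (map (proj₁ (arrows λ _ _ _ → false)) (# 0))

corollary7p2 : Σ OrderedTwoGraph λ B → ∀ (C : OrderedTwoGraph) → ¬ Arrows C B
corollary7p2 = B , noArrow
  where
    noArrow : ∀ (C : OrderedTwoGraph) → ¬ Arrows C B
    noArrow C arrows with arrows (linkColouring C (leastVertex arrows))
    ... | f , col , mono-col =
      noLinkMonochromaticB f (leastVertex arrows) col mono-col
        (≤-<-trans (least-≤ _ (map f (# 0))) (mono f (n<1+n 0)))
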